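{- Let $G$ be an abelian group of order $v$ and let $m\ge 3$. Then there does not exist a classical $(v,m,k,\lambda)$-PSEDF in $G$.
   Context: For subsets $A,B$ of an additively written group $G$, $\Delta(A,B)$ denotes the multiset $\{a-b: a\in A, b\in B\}$ (one entry for each pair). For a set $S$ and $\lambda\in\mathbb{N}$, $\lambda S$ denotes the multiset consisting of $\lambda$ copies of $S$. A classical $(v,m,k,\lambda)$-PSEDF in a group $G$ of order $v$ is a family of $m$ pairwise disjoint $k$-subsets $\{A_1,\dots,A_m\}$ of $G$ such that for every $1\le i\ne j\le m$ the multiset equation $\Delta(A_i,A_j)=\lambda(G\setminus\{0\})$ holds. -}

module Defs where

open import Data.Nat using (ℕ)
open import Data.Bool using (Bool; true; false; _∧_; if_then_else_)
open import Data.Fin using (Fin; _≟_)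
open import Data.Fin.Subset using (Subset; _∈_; ∣_∣)
open import Data.Vec using (lookup)
open import Data.List using (map; allFin)
open import Data.Nat.ListAction using (sum)
open import Relation.Nullary using (¬_)
open import Relation.Nullary.Decidable using (⌊_⌋)
open import Relation.Binary.PropositionalEquality using (_≡_; _≢_)
open import Algebra.Structures using (IsAbelianGroup)

-- An abelian group of order v, presented (up to isomorphism) on the carrier
-- Fin v with propositional equality, using the stdlib's IsAbelianGroup.
record FinAbGroup (v : ℕ) : Set where
  field
    _+ᴳ_ : Fin v → Fin v → Fin v
    0ᴳ   : Fin v
    -ᴳ_  : Fin v → Fin v
    isAbelianGroup : IsAbelianGroup _≡_ _+ᴳ_ 0ᴳ -ᴳ_

  _-ᴳ_ : Fin v → Fin v → Fin v
  x -ᴳ y = x +ᴳ (-ᴳ y)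

module _ {v : ℕ} (G : FinAbGroup v) where
  open FinAbGroup G

  -- Multiplicity of g in the multiset Δ(A,B) = {a - b : a ∈ A, b ∈ B}
  -- (one entry per pair (a,b)).
  Δmult : Subset v → Subset v → Fin v → ℕ
  Δmult A B g =
    sum (map (λ a → sum (map (λ b →
           if lookup A a ∧ lookup B b ∧ ⌊ (a -ᴳ b) ≟ g ⌋ then 1 else 0)
         (allFin v))) (allFin v))

  λGstarMult : ℕ → Fin v → ℕ
  λGstarMult λ' g = if ⌊ g ≟ 0ᴳ ⌋ then 0 else λ'

  -- Multiset equation Δ(A,B) = λ(G ∖ {0}), as equality of multiplicities.
  ΔEq : Subset v → Subset v → ℕ → Set
  ΔEq A B λ' = ∀ (g : Fin v) → Δmult A B g ≡ λGstarMult λ' g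

  record IsPSEDF (m k λ' : ℕ) (A : Fin m → Subset v) : Set where
    field
      size     : ∀ i → ∣ A i ∣ ≡ k
      disjoint : ∀ i j → i ≢ j → ∀ x → x ∈ A i → ¬ (x ∈ A j)
      diffs    : ∀ i j → i ≢ j → ΔEq (A i) (A j) λ'

{-# OPTIONS --safe #-}
module Submission where

-- Counting quadruples (a , b , c , d) ∈ A × B × C × D with a − b = c − d, equivalently (G being
-- abelian) a − c = b − d, gives Σ_g Δ(A,B)(g)·Δ(C,D)(g) = Σ_g Δ(A,C)(g)·Δ(B,D)(g). Take three
-- sets A, B, C of a PSEDF and D = B. The left side is Σ_g (λ(G∖{0}))(g)² = λ · λ(v − 1) = λk²,
-- the right side is λ times the mass of Δ(B,B) off 0, i.e. λ(k² − k). Hence λk = 0, so λ = 0,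
-- which contradicts k² = λ(v − 1).

open import Defs
open import Algebra.Bundles using (AbelianGroup)
import Algebra.Properties.AbelianGroup
open import Algebra.Structures using (IsAbelianGroup)
open import Data.Bool using (Bool; true; false; _∧_; if_then_else_)
open import Data.Fin using (Fin; zero; suc; _≟_)
open import Data.Fin.Patterns using (0F; 1F; 2F)
open import Data.Fin.Subset using (Subset; ∣_∣)
import Data.List as List using (map; tabulate; allFin)
open import Data.List.Properties using (map-tabulate)
import Data.Nat.ListAction as List using (sum)
open import Data.Nat using (ℕ; zero; suc; _+_; _*_; _≤_; s≤s)
open import Data.Nat.Properties
  using (+-*-semiring; +-identityʳ; *-identityˡ; *-identityʳ; *-zeroʳ; *-assoc; *-comm;
         *-distribʳ-+; +-cancelˡ-≡; m*n≡0⇒m≡0; 1+n≢0)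
open import Data.Nat.Tactic.RingSolver using (solve-∀)
open import Data.Vec using ([]; _∷_; lookup)
open import Function using (_∘_; id)
open import Level using (0ℓ)
open import Relation.Nullary using (¬_; Dec; does; yes; no; contradiction)
open import Relation.Nullary.Decidable using (isYes; isYes≗does)
open import Relation.Binary.PropositionalEquality
  using (_≡_; refl; sym; trans; cong; cong₂; subst; module ≡-Reasoning)
open import Algebra.Properties.Semiring.Sum +-*-semiring
  using (sum; sum-syntax; sum-cong-≗; ∑-comm; ∑-distrib-+; sum-replicate-zero;
         *-distribˡ-sum; *-distribʳ-sum)

open ≡-Reasoning

iverson : Bool → ℕ
iverson b = if b then 1 else 0

iverson-∧ : ∀ a b → iverson (a ∧ b) ≡ iverson a * iverson b
iverson-∧ true  b = sym (+-identityʳ (iverson b))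
iverson-∧ false b = refl

-- Via does rather than ⌊_⌋, so that δ (suc x) (suc y) reduces to δ x y.
δ : ∀ {n} → Fin n → Fin n → ℕ
δ x y = iverson (does (x ≟ y))

δ-cong-⇔ : ∀ {n} {x y x′ y′ : Fin n} →
           (x ≡ y → x′ ≡ y′) → (x′ ≡ y′ → x ≡ y) → δ x y ≡ δ x′ y′
δ-cong-⇔ {x = x} {y} {x′} {y′} to from with x ≟ y | x′ ≟ y′
... | yes _   | yes _    = refl
... | no  _   | no  _    = refl
... | yes x≡y | no  x′≢y′ = contradiction (to x≡y) x′≢y′
... | no  x≢y | yes x′≡y′ = contradiction (from x′≡y′) x≢y

δ-sym : ∀ {n} (x y : Fin n) → δ x y ≡ δ y x
δ-sym x y = δ-cong-⇔ {x = x} {y} {y} {x} sym sym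

sum-δ : ∀ {n} (x : Fin n) (f : Fin n → ℕ) → ∑[ y < n ] (δ x y * f y) ≡ f x
sum-δ {suc n} zero    f = trans (cong₂ _+_ (*-identityˡ (f zero)) (sum-replicate-zero n))
                                (+-identityʳ (f zero))
sum-δ {suc n} (suc x) f = sum-δ x (f ∘ suc)

sum-tabulate : ∀ {n} (f : Fin n → ℕ) → List.sum (List.tabulate f) ≡ sum f
sum-tabulate {zero}  f = refl
sum-tabulate {suc n} f = cong (f zero +_) (sum-tabulate (f ∘ suc))

sum-allFin : ∀ {n} (f : Fin n → ℕ) → List.sum (List.map f (List.allFin n)) ≡ sum f
sum-allFin f = trans (cong List.sum (map-tabulate id f)) (sum-tabulate f)

χ : ∀ {n} → Subset n → Fin n → ℕ
χ A a = iverson (lookup A a)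

χ-idem : ∀ {n} (A : Subset n) a → χ A a * χ A a ≡ χ A a
χ-idem A a with lookup A a
... | true  = refl
... | false = refl

∣∣≡sum-χ : ∀ {n} (A : Subset n) → ∣ A ∣ ≡ ∑[ a < n ] χ A a
∣∣≡sum-χ []          = refl
∣∣≡sum-χ (true  ∷ A) = cong suc (∣∣≡sum-χ A)
∣∣≡sum-χ (false ∷ A) = ∣∣≡sum-χ A

module _ {v : ℕ} (G : FinAbGroup v) where
  open FinAbGroup G
  open IsAbelianGroup isAbelianGroup using (assoc; identityˡ; inverseˡ; comm)

  private
    abelianGroup : AbelianGroup 0ℓ 0ℓ
    abelianGroup = record { isAbelianGroup = isAbelianGroup }

  open Algebra.Properties.AbelianGroup abelianGroup using (x∙y⁻¹≈ε⇒x≈y; x≈y⇒x∙y⁻¹≈ε)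

  -ᴳ-telescope : ∀ x y z → (x -ᴳ y) +ᴳ (y -ᴳ z) ≡ x -ᴳ z
  -ᴳ-telescope x y z = begin
    (x +ᴳ (-ᴳ y)) +ᴳ (y +ᴳ (-ᴳ z)) ≡⟨ assoc x (-ᴳ y) (y +ᴳ (-ᴳ z)) ⟩
    x +ᴳ ((-ᴳ y) +ᴳ (y +ᴳ (-ᴳ z))) ≡⟨ cong (x +ᴳ_) (sym (assoc (-ᴳ y) y (-ᴳ z))) ⟩
    x +ᴳ (((-ᴳ y) +ᴳ y) +ᴳ (-ᴳ z)) ≡⟨ cong (λ t → x +ᴳ (t +ᴳ (-ᴳ z))) (inverseˡ y) ⟩
    x +ᴳ (0ᴳ +ᴳ (-ᴳ z))            ≡⟨ cong (x +ᴳ_) (identityˡ (-ᴳ z)) ⟩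
    x +ᴳ (-ᴳ z)                    ∎

  -ᴳ-exchange : ∀ {a b c d} → c -ᴳ d ≡ a -ᴳ b → b -ᴳ d ≡ a -ᴳ c
  -ᴳ-exchange {a} {b} {c} {d} c-d≡a-b = begin
    b -ᴳ d                  ≡⟨ sym (-ᴳ-telescope b c d) ⟩
    (b -ᴳ c) +ᴳ (c -ᴳ d)    ≡⟨ cong ((b -ᴳ c) +ᴳ_) c-d≡a-b ⟩
    (b -ᴳ c) +ᴳ (a -ᴳ b)    ≡⟨ comm (b -ᴳ c) (a -ᴳ b) ⟩
    (a -ᴳ b) +ᴳ (b -ᴳ c)    ≡⟨ -ᴳ-telescope a b c ⟩
    a -ᴳ c                  ∎

  δ-exchange : ∀ a b c d → δ (c -ᴳ d) (a -ᴳ b) ≡ δ (b -ᴳ d) (a -ᴳ c)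
  δ-exchange a b c d = δ-cong-⇔ {x = c -ᴳ d} {a -ᴳ b} {b -ᴳ d} {a -ᴳ c} -ᴳ-exchange -ᴳ-exchange

  δ-difference-zero : ∀ a b → δ (a -ᴳ b) 0ᴳ ≡ δ a b
  δ-difference-zero a b = δ-cong-⇔ {x = a -ᴳ b} {0ᴳ} {a} {b} (x∙y⁻¹≈ε⇒x≈y a b) x≈y⇒x∙y⁻¹≈ε

  Δmult-expand : ∀ A B g →
    Δmult G A B g ≡ ∑[ a < v ] ∑[ b < v ] (χ A a * χ B b * δ (a -ᴳ b) g)
  Δmult-expand A B g =
    trans (sum-allFin (λ a → List.sum (List.map (entry a) (List.allFin v))))
          (sum-cong-≗ λ a → trans (sum-allFin (entry a)) (sum-cong-≗ λ b →
            iverson-∧₃ (lookup A a) (lookup B b) ((a -ᴳ b) ≟ g)))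
    where
    entry : Fin v → Fin v → ℕ
    entry a b = iverson (lookup A a ∧ lookup B b ∧ isYes ((a -ᴳ b) ≟ g))

    iverson-∧₃ : ∀ {P : Set} x y (d : Dec P) →
                 iverson (x ∧ y ∧ isYes d) ≡ iverson x * iverson y * iverson (does d)
    iverson-∧₃ x y d = begin
      iverson (x ∧ y ∧ isYes d)                   ≡⟨ iverson-∧ x (y ∧ isYes d) ⟩
      iverson x * iverson (y ∧ isYes d)           ≡⟨ cong (iverson x *_) (iverson-∧ y (isYes d)) ⟩
      iverson x * (iverson y * iverson (isYes d)) ≡⟨ sym (*-assoc (iverson x) (iverson y) _) ⟩
      iverson x * iverson y * iverson (isYes d)
        ≡⟨ cong (λ t → iverson x * iverson y * iverson t) (isYes≗does d) ⟩
      iverson x * iverson y * iverson (does d)    ∎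

  sum-Δmult-weighted : ∀ A B (F : Fin v → ℕ) →
    ∑[ g < v ] (Δmult G A B g * F g) ≡ ∑[ a < v ] ∑[ b < v ] (χ A a * χ B b * F (a -ᴳ b))
  sum-Δmult-weighted A B F = begin
    ∑[ g < v ] (Δmult G A B g * F g)
      ≡⟨ sum-cong-≗ (λ g → cong (_* F g) (Δmult-expand A B g)) ⟩
    ∑[ g < v ] ((∑[ a < v ] ∑[ b < v ] t g a b) * F g)
      ≡⟨ sum-cong-≗ (λ g → trans (*-distribʳ-sum (F g) (λ a → ∑[ b < v ] t g a b))
                                 (sum-cong-≗ λ a → *-distribʳ-sum (F g) (t g a))) ⟩
    ∑[ g < v ] ∑[ a < v ] ∑[ b < v ] (t g a b * F g)
      ≡⟨ ∑-comm (λ g a → ∑[ b < v ] (t g a b * F g)) ⟩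
    ∑[ a < v ] ∑[ g < v ] ∑[ b < v ] (t g a b * F g)
      ≡⟨ sum-cong-≗ (λ a → ∑-comm (λ g b → t g a b * F g)) ⟩
    ∑[ a < v ] ∑[ b < v ] ∑[ g < v ] (w a b * δ (a -ᴳ b) g * F g)
      ≡⟨ sum-cong-≗ (λ a → sum-cong-≗ λ b → sum-scaled-δ (w a b) (a -ᴳ b)) ⟩
    ∑[ a < v ] ∑[ b < v ] (w a b * F (a -ᴳ b)) ∎
    where
    w : Fin v → Fin v → ℕ
    w a b = χ A a * χ B b

    t : Fin v → Fin v → Fin v → ℕ
    t g a b = w a b * δ (a -ᴳ b) g

    sum-scaled-δ : ∀ c x → ∑[ g < v ] (c * δ x g * F g) ≡ c * F x
    sum-scaled-δ c x = begin
      ∑[ g < v ] (c * δ x g * F g)   ≡⟨ sum-cong-≗ (λ g → *-assoc c (δ x g) (F g)) ⟩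
      ∑[ g < v ] (c * (δ x g * F g)) ≡⟨ sym (*-distribˡ-sum c (λ g → δ x g * F g)) ⟩
      c * ∑[ g < v ] (δ x g * F g)   ≡⟨ cong (c *_) (sum-δ x F) ⟩
      c * F x                        ∎

  sum-Δmult : ∀ A B → ∑[ g < v ] Δmult G A B g ≡ ∣ A ∣ * ∣ B ∣
  sum-Δmult A B = begin
    ∑[ g < v ] Δmult G A B g
      ≡⟨ sum-cong-≗ (λ g → sym (*-identityʳ (Δmult G A B g))) ⟩
    ∑[ g < v ] (Δmult G A B g * 1)
      ≡⟨ sum-Δmult-weighted A B (λ _ → 1) ⟩
    ∑[ a < v ] ∑[ b < v ] (χ A a * χ B b * 1)
      ≡⟨ sum-cong-≗ (λ a → sum-cong-≗ λ b → *-identityʳ (χ A a * χ B b)) ⟩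
    ∑[ a < v ] ∑[ b < v ] (χ A a * χ B b)
      ≡⟨ sum-cong-≗ (λ a → sym (*-distribˡ-sum (χ A a) (χ B))) ⟩
    ∑[ a < v ] (χ A a * ∑[ b < v ] χ B b)
      ≡⟨ sym (*-distribʳ-sum (∑[ b < v ] χ B b) (χ A)) ⟩
    ∑[ a < v ] χ A a * ∑[ b < v ] χ B b
      ≡⟨ sym (cong₂ _*_ (∣∣≡sum-χ A) (∣∣≡sum-χ B)) ⟩
    ∣ A ∣ * ∣ B ∣ ∎

  Δmult-self-0ᴳ : ∀ A → Δmult G A A 0ᴳ ≡ ∣ A ∣
  Δmult-self-0ᴳ A = begin
    Δmult G A A 0ᴳ
      ≡⟨ Δmult-expand A A 0ᴳ ⟩
    ∑[ a < v ] ∑[ b < v ] (χ A a * χ A b * δ (a -ᴳ b) 0ᴳ)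
      ≡⟨ sum-cong-≗ (λ a → sum-cong-≗ λ b →
           trans (cong (χ A a * χ A b *_) (δ-difference-zero a b)) (*-comm (χ A a * χ A b) (δ a b))) ⟩
    ∑[ a < v ] ∑[ b < v ] (δ a b * (χ A a * χ A b))
      ≡⟨ sum-cong-≗ (λ a → sum-δ a (λ b → χ A a * χ A b)) ⟩
    ∑[ a < v ] (χ A a * χ A a)
      ≡⟨ sum-cong-≗ (χ-idem A) ⟩
    ∑[ a < v ] χ A a
      ≡⟨ sym (∣∣≡sum-χ A) ⟩
    ∣ A ∣ ∎

  coincidence : Subset v → Subset v → Subset v → Subset v → Fin v → Fin v → Fin v → Fin v → ℕ
  coincidence A B C D a b c d = χ A a * χ B b * (χ C c * χ D d * δ (c -ᴳ d) (a -ᴳ b))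

  coincidence-exchange : ∀ A B C D a b c d →
    coincidence A B C D a b c d ≡ coincidence A C B D a c b d
  coincidence-exchange A B C D a b c d rewrite δ-exchange a b c d =
    middle-exchange (χ A a) (χ B b) (χ C c) (χ D d) (δ (b -ᴳ d) (a -ᴳ c))
    where
    middle-exchange : ∀ p q r s e → p * q * (r * s * e) ≡ p * r * (q * s * e)
    middle-exchange = solve-∀

  sum-Δmult-product : ∀ A B C D →
    ∑[ g < v ] (Δmult G A B g * Δmult G C D g) ≡
    ∑[ a < v ] ∑[ b < v ] ∑[ c < v ] ∑[ d < v ] coincidence A B C D a b c d
  sum-Δmult-product A B C D =
    trans (sum-Δmult-weighted A B (Δmult G C D)) (sum-cong-≗ λ a → sum-cong-≗ λ b →
      trans (cong (χ A a * χ B b *_) (Δmult-expand C D (a -ᴳ b)))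
            (trans (*-distribˡ-sum (χ A a * χ B b) (λ c → ∑[ d < v ] term a b c d))
                   (sum-cong-≗ λ c → *-distribˡ-sum (χ A a * χ B b) (term a b c))))
    where
    term : Fin v → Fin v → Fin v → Fin v → ℕ
    term a b c d = χ C c * χ D d * δ (c -ᴳ d) (a -ᴳ b)

  sum-Δmult-product-exchange : ∀ A B C D →
    ∑[ g < v ] (Δmult G A B g * Δmult G C D g) ≡ ∑[ g < v ] (Δmult G A C g * Δmult G B D g)
  sum-Δmult-product-exchange A B C D = begin
    ∑[ g < v ] (Δmult G A B g * Δmult G C D g)
      ≡⟨ sum-Δmult-product A B C D ⟩
    ∑[ a < v ] ∑[ b < v ] ∑[ c < v ] ∑[ d < v ] coincidence A B C D a b c d
      ≡⟨ sum-cong-≗ (λ a → ∑-comm (λ b c → ∑[ d < v ] coincidence A B C D a b c d)) ⟩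
    ∑[ a < v ] ∑[ c < v ] ∑[ b < v ] ∑[ d < v ] coincidence A B C D a b c d
      ≡⟨ sum-cong-≗ (λ a → sum-cong-≗ λ c → sum-cong-≗ λ b → sum-cong-≗ λ d →
           coincidence-exchange A B C D a b c d) ⟩
    ∑[ a < v ] ∑[ c < v ] ∑[ b < v ] ∑[ d < v ] coincidence A C B D a c b d
      ≡⟨ sym (sum-Δmult-product A C B D) ⟩
    ∑[ g < v ] (Δmult G A C g * Δmult G B D g) ∎

  λGstarMult-sq : ∀ λ' g → λGstarMult G λ' g * λGstarMult G λ' g ≡ λ' * λGstarMult G λ' g
  λGstarMult-sq λ' g with g ≟ 0ᴳ
  ... | yes _ = sym (*-zeroʳ λ')
  ... | no  _ = refl

  λGstarMult-zeroˡ : ∀ g → λGstarMult G 0 g ≡ 0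
  λGstarMult-zeroˡ g with g ≟ 0ᴳ
  ... | yes _ = refl
  ... | no  _ = refl

  λGstarMult-+-δ : ∀ λ' g → λGstarMult G λ' g + λ' * δ g 0ᴳ ≡ λ'
  λGstarMult-+-δ λ' g with g ≟ 0ᴳ
  ... | yes _ = *-identityʳ λ'
  ... | no  _ = trans (cong (λ' +_) (*-zeroʳ λ')) (+-identityʳ λ')

  sum-λGstarMult-weighted : ∀ λ' (F : Fin v → ℕ) →
    ∑[ g < v ] (λGstarMult G λ' g * F g) + λ' * F 0ᴳ ≡ λ' * ∑[ g < v ] F g
  sum-λGstarMult-weighted λ' F = begin
    ∑[ g < v ] (λG g * F g) + λ' * F 0ᴳ
      ≡⟨ cong (λ t → ∑[ g < v ] (λG g * F g) + λ' * t) (sym (sum-δ 0ᴳ F)) ⟩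
    ∑[ g < v ] (λG g * F g) + λ' * ∑[ g < v ] (δ 0ᴳ g * F g)
      ≡⟨ cong (∑[ g < v ] (λG g * F g) +_) (*-distribˡ-sum λ' (λ g → δ 0ᴳ g * F g)) ⟩
    ∑[ g < v ] (λG g * F g) + ∑[ g < v ] (λ' * (δ 0ᴳ g * F g))
      ≡⟨ sym (∑-distrib-+ (λ g → λG g * F g) (λ g → λ' * (δ 0ᴳ g * F g))) ⟩
    ∑[ g < v ] (λG g * F g + λ' * (δ 0ᴳ g * F g))
      ≡⟨ sum-cong-≗ split ⟩
    ∑[ g < v ] (λ' * F g)
      ≡⟨ sym (*-distribˡ-sum λ' F) ⟩
    λ' * ∑[ g < v ] F g ∎
    where
    λG : Fin v → ℕ
    λG = λGstarMult G λ'

    split : ∀ g → λG g * F g + λ' * (δ 0ᴳ g * F g) ≡ λ' * F g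
    split g = begin
      λG g * F g + λ' * (δ 0ᴳ g * F g) ≡⟨ cong (λ t → λG g * F g + λ' * (t * F g)) (δ-sym 0ᴳ g) ⟩
      λG g * F g + λ' * (δ g 0ᴳ * F g) ≡⟨ cong (λG g * F g +_) (sym (*-assoc λ' (δ g 0ᴳ) (F g))) ⟩
      λG g * F g + λ' * δ g 0ᴳ * F g   ≡⟨ sym (*-distribʳ-+ (F g) (λG g) (λ' * δ g 0ᴳ)) ⟩
      (λG g + λ' * δ g 0ᴳ) * F g       ≡⟨ cong (_* F g) (λGstarMult-+-δ λ' g) ⟩
      λ' * F g                         ∎

  ΔEq-0⇒∣A∣*∣B∣≡0 : ∀ A B → ΔEq G A B 0 → ∣ A ∣ * ∣ B ∣ ≡ 0
  ΔEq-0⇒∣A∣*∣B∣≡0 A B ΔAB≡0 = begin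
    ∣ A ∣ * ∣ B ∣             ≡⟨ sym (sum-Δmult A B) ⟩
    ∑[ g < v ] Δmult G A B g  ≡⟨ sum-cong-≗ (λ g → trans (ΔAB≡0 g) (λGstarMult-zeroˡ g)) ⟩
    ∑[ g < v ] 0              ≡⟨ sum-replicate-zero v ⟩
    0                         ∎

  ΔEq-triple⇒λ*k≡0 : ∀ A B C {k λ'} → ∣ A ∣ ≡ k → ∣ B ∣ ≡ k →
    ΔEq G A B λ' → ΔEq G C B λ' → ΔEq G A C λ' → λ' * k ≡ 0
  ΔEq-triple⇒λ*k≡0 A B C {k} {λ'} ∣A∣≡k ∣B∣≡k ΔAB ΔCB ΔAC =
    +-cancelˡ-≡ X (λ' * k) 0 (trans X+λk≡λk² (trans (sym X≡λk²) (sym (+-identityʳ X))))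
    where
    λG : Fin v → ℕ
    λG = λGstarMult G λ'

    X : ℕ
    X = ∑[ g < v ] (λG g * Δmult G B B g)

    sum-λG≡k² : ∑[ g < v ] λG g ≡ k * k
    sum-λG≡k² = begin
      ∑[ g < v ] λG g           ≡⟨ sum-cong-≗ (λ g → sym (ΔAB g)) ⟩
      ∑[ g < v ] Δmult G A B g  ≡⟨ sum-Δmult A B ⟩
      ∣ A ∣ * ∣ B ∣             ≡⟨ cong₂ _*_ ∣A∣≡k ∣B∣≡k ⟩
      k * k                     ∎

    X+λk≡λk² : X + λ' * k ≡ λ' * (k * k)
    X+λk≡λk² = begin
      X + λ' * k                    ≡⟨ cong (λ t → X + λ' * t) (sym (trans (Δmult-self-0ᴳ B) ∣B∣≡k)) ⟩
      X + λ' * Δmult G B B 0ᴳ       ≡⟨ sum-λGstarMult-weighted λ' (Δmult G B B) ⟩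
      λ' * ∑[ g < v ] Δmult G B B g ≡⟨ cong (λ' *_) (trans (sum-Δmult B B) (cong₂ _*_ ∣B∣≡k ∣B∣≡k)) ⟩
      λ' * (k * k)                  ∎

    X≡λk² : X ≡ λ' * (k * k)
    X≡λk² = begin
      X                                          ≡⟨ sum-cong-≗ (λ g → cong (_* Δmult G B B g) (sym (ΔAC g))) ⟩
      ∑[ g < v ] (Δmult G A C g * Δmult G B B g) ≡⟨ sym (sum-Δmult-product-exchange A B C B) ⟩
      ∑[ g < v ] (Δmult G A B g * Δmult G C B g) ≡⟨ sum-cong-≗ (λ g → cong₂ _*_ (ΔAB g) (ΔCB g)) ⟩
      ∑[ g < v ] (λG g * λG g)                   ≡⟨ sum-cong-≗ (λGstarMult-sq λ') ⟩
      ∑[ g < v ] (λ' * λG g)                     ≡⟨ sym (*-distribˡ-sum λ' λG) ⟩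
      λ' * ∑[ g < v ] λG g                       ≡⟨ cong (λ' *_) sum-λG≡k² ⟩
      λ' * (k * k)                               ∎

theorem2p22 : ∀ {v : ℕ} (G : FinAbGroup v) (m k λ' : ℕ) → 3 ≤ m → 1 ≤ k →
    (A : Fin m → Subset v) → ¬ IsPSEDF G m k λ' A
theorem2p22 G _ (suc k) λ' (s≤s (s≤s (s≤s _))) _ A psedf =
  1+n≢0 (trans (sym (cong₂ _*_ (size 0F) (size 1F))) (ΔEq-0⇒∣A∣*∣B∣≡0 G (A 0F) (A 1F) Δ₀₁≡0))
  where
  open IsPSEDF psedf

  λ'≡0 : λ' ≡ 0
  λ'≡0 = m*n≡0⇒m≡0 λ' (suc k) (ΔEq-triple⇒λ*k≡0 G (A 0F) (A 1F) (A 2F) (size 0F) (size 1F)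
                                 (diffs 0F 1F λ ()) (diffs 2F 1F λ ()) (diffs 0F 2F λ ()))

  Δ₀₁≡0 : ΔEq G (A 0F) (A 1F) 0
  Δ₀₁≡0 = subst (ΔEq G (A 0F) (A 1F)) λ'≡0 (diffs 0F 1F λ ())
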